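{- Let $f(x,y)$ be a binary quadratic form with integer coefficients and non-zero discriminant, and let $X_f$ be the quadric surface in $\mathbb{P}^3$ defined by $f(x_1,x_2) = f(x_3,x_4)$. Then every point of $X_f(\mathbb{Q})$ lies on a line defined over $\mathbb{Q}$ that is contained in $X_f$.
   Context: $X_f(\mathbb{Q})$ denotes the set of rational points of $X_f$. A rational line is a line defined over $\mathbb{Q}$. -}

module Defs where

open import Data.Integer.Base using (ℤ)
open import Data.Rational.Base using (ℚ; _/_; _+_; _*_; _-_; 0ℚ)
open import Data.Product.Base using (_×_; Σ-syntax; ∃-syntax)
open import Relation.Binary.PropositionalEquality using (_≡_)
open import Relation.Nullary.Negation using (¬_)

ι : ℤ → ℚ
ι z = z / 1

record BQF : Set where
  constructor bqf
  field
    a b c : ℤ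

open BQF public

disc : BQF → ℤ
disc f = b f ℤ.* b f ℤ.- (ℤ.+ 4) ℤ.* a f ℤ.* c f
  where import Data.Integer.Base as ℤ

evalQ : BQF → ℚ → ℚ → ℚ
evalQ f x y = ι (a f) * x * x + ι (b f) * x * y + ι (c f) * y * y

-- vectors in ℚ⁴ (homogeneous coordinates of ℙ³)
record Q4 : Set where
  constructor q4
  field
    x₁ x₂ x₃ x₄ : ℚ

open Q4 public

zero4 : Q4
zero4 = q4 0ℚ 0ℚ 0ℚ 0ℚ

_+₄_ : Q4 → Q4 → Q4
u +₄ v = q4 (x₁ u + x₁ v) (x₂ u + x₂ v) (x₃ u + x₃ v) (x₄ u + x₄ v)

_·₄_ : ℚ → Q4 → Q4
t ·₄ v = q4 (t * x₁ v) (t * x₂ v) (t * x₃ v) (t * x₄ v)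

OnX : BQF → Q4 → Set
OnX f P = evalQ f (x₁ P) (x₂ P) ≡ evalQ f (x₃ P) (x₄ P)

RationalPoint : BQF → Q4 → Set
RationalPoint f P = ¬ (P ≡ zero4) × OnX f P

LinIndep : Q4 → Q4 → Set
LinIndep u v = ∀ (s t : ℚ) → (s ·₄ u) +₄ (t ·₄ v) ≡ zero4 → (s ≡ 0ℚ × t ≡ 0ℚ)

-- the rational line spanned by u and v (a 2-dim subspace of ℚ⁴) is contained in X_f
LineInX : BQF → Q4 → Q4 → Set
LineInX f u v = ∀ (s t : ℚ) → OnX f ((s ·₄ u) +₄ (t ·₄ v))

OnLine : Q4 → Q4 → Q4 → Set
OnLine P u v = ∃[ s ] ∃[ t ] P ≡ (s ·₄ u) +₄ (t ·₄ v)

{-# OPTIONS --safe #-}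
-- Write P = (p, q) with p, q ∈ ℚ². On the plane spanned by P and a diagonal vector (w, w),
-- f(x₁,x₂) − f(x₃,x₄) restricts to t²(f(p) − f(q)) + s t β(w, p − q), with β the polar form of f.
-- If p = q, P lies on the diagonal line {(x, x)} ⊆ X_f. Otherwise take w to be β-orthogonal to
-- d = p − q: the explicit rational choice w = (−(b d₁ + 2c d₂), 2a d₁ + b d₂) is nonzero because
-- disc f ≠ 0, and then the line through (w, w) and P lies on X_f.
module Submission where

open import Defs
open import Data.Integer.Base as ℤ using (ℤ; 0ℤ; +_; -[1+_])
import Data.Integer.Properties as ℤ
open import Data.Nat.Base using (suc)
import Data.Nat.Coprimality as Coprimality
open import Data.Rational.Base
open import Data.Rational.Properties using (_≟_; normalize-coprime; mkℚ-injective; *-identityˡ; *-inverseˡ; *-assoc; *-zeroʳ; *-comm; +-0-group)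
open import Data.Rational.Solver using (module +-*-Solver)
open import Algebra.Properties.Group +-0-group using (⁻¹-involutive; x∙y⁻¹≈ε⇒x≈y; x≈y⇒x∙y⁻¹≈ε)
open import Data.Product.Base using (_×_; _,_; proj₁; ∃-syntax)
open import Data.Sum.Base using (_⊎_; inj₁; inj₂)
open import Relation.Nullary using (yes; no; ¬_; contradiction)
open import Relation.Binary.PropositionalEquality

open +-*-Solver

ι-canonical : ∀ z → ι z ≡ mkℚ z 0 (Coprimality.sym (Coprimality.1-coprimeTo ℤ.∣ z ∣))
ι-canonical (+ n)    = normalize-coprime (Coprimality.sym (Coprimality.1-coprimeTo n))
ι-canonical -[1+ n ] = cong -_ (normalize-coprime (Coprimality.sym (Coprimality.1-coprimeTo (suc n))))

ι-homo-* : ∀ x y → ι (x ℤ.* y) ≡ ι x * ι y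
ι-homo-* x y rewrite ι-canonical x | ι-canonical y = refl

ι-homo-+ : ∀ x y → ι (x ℤ.+ y) ≡ ι x + ι y
ι-homo-+ x y rewrite ι-canonical x | ι-canonical y =
  cong ι (cong₂ ℤ._+_ (sym (ℤ.*-identityʳ x)) (sym (ℤ.*-identityʳ y)))

ι-homo-neg : ∀ x → ι (ℤ.- x) ≡ - ι x
ι-homo-neg (+ 0)       = refl
ι-homo-neg (+ (suc n)) = refl
ι-homo-neg -[1+ n ]    = sym (⁻¹-involutive (ι (+ suc n)))

ι[z]≡0⇒z≡0 : ∀ z → ι z ≡ 0ℚ → z ≡ 0ℤ
ι[z]≡0⇒z≡0 z ιz≡0 = proj₁ (mkℚ-injective (trans (sym (ι-canonical z)) ιz≡0))

x*y≡0∧x≢0⇒y≡0 : ∀ x y → x * y ≡ 0ℚ → x ≢ 0ℚ → y ≡ 0ℚ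
x*y≡0∧x≢0⇒y≡0 x y xy≡0 x≢0 = begin
  y                ≡⟨ sym (*-identityˡ y) ⟩
  1ℚ * y           ≡⟨ cong (_* y) (sym (*-inverseˡ x)) ⟩
  (1/ x) * x * y   ≡⟨ *-assoc (1/ x) x y ⟩
  (1/ x) * (x * y) ≡⟨ cong (1/ x *_) xy≡0 ⟩
  (1/ x) * 0ℚ      ≡⟨ *-zeroʳ (1/ x) ⟩
  0ℚ               ∎
  where open ≡-Reasoning
        instance _ = ≢-nonZero x≢0

NonZeroPair : ℚ → ℚ → Set
NonZeroPair x y = x ≢ 0ℚ ⊎ y ≢ 0ℚ

annihilator-of-nonZeroPair : ∀ s x y → s * x ≡ 0ℚ → s * y ≡ 0ℚ → NonZeroPair x y → s ≡ 0ℚ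
annihilator-of-nonZeroPair s x y sx≡0 _    (inj₁ x≢0) = x*y≡0∧x≢0⇒y≡0 x s (trans (*-comm x s) sx≡0) x≢0
annihilator-of-nonZeroPair s x y _    sy≡0 (inj₂ y≢0) = x*y≡0∧x≢0⇒y≡0 y s (trans (*-comm y s) sy≡0) y≢0

x*0+y*0≡0 : ∀ x y → x * 0ℚ + y * 0ℚ ≡ 0ℚ
x*0+y*0≡0 = solve 2 (λ x y → x :* con 0ℚ :+ y :* con 0ℚ := con 0ℚ) refl

2ℚ : ℚ
2ℚ = 1ℚ + 1ℚ

discQ : BQF → ℚ
discQ f = ι (b f) * ι (b f) - ι (+ 4) * ι (a f) * ι (c f)

ι-disc : ∀ f → ι (disc f) ≡ discQ f
ι-disc f = begin
  ι (b f ℤ.* b f ℤ.- + 4 ℤ.* a f ℤ.* c f)          ≡⟨ ι-homo-+ (b f ℤ.* b f) (ℤ.- (+ 4 ℤ.* a f ℤ.* c f)) ⟩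
  ι (b f ℤ.* b f) + ι (ℤ.- (+ 4 ℤ.* a f ℤ.* c f))  ≡⟨ cong₂ _+_ (ι-homo-* (b f) (b f)) (ι-homo-neg (+ 4 ℤ.* a f ℤ.* c f)) ⟩
  ι (b f) * ι (b f) - ι (+ 4 ℤ.* a f ℤ.* c f)       ≡⟨ cong (λ z → ι (b f) * ι (b f) - z) ι[4ac]≡4ιaιc ⟩
  discQ f                                            ∎
  where
  open ≡-Reasoning
  ι[4ac]≡4ιaιc : ι (+ 4 ℤ.* a f ℤ.* c f) ≡ ι (+ 4) * ι (a f) * ι (c f)
  ι[4ac]≡4ιaιc = trans (ι-homo-* (+ 4 ℤ.* a f) (c f)) (cong (_* ι (c f)) (ι-homo-* (+ 4) (a f)))

polar : BQF → ℚ → ℚ → ℚ → ℚ → ℚ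
polar f x y x′ y′ = 2ℚ * ι (a f) * x * x′ + ι (b f) * (x * y′ + y * x′) + 2ℚ * ι (c f) * y * y′

perp₁ perp₂ : BQF → ℚ → ℚ → ℚ
perp₁ f x y = - (ι (b f) * x + 2ℚ * ι (c f) * y)
perp₂ f x y = 2ℚ * ι (a f) * x + ι (b f) * y

polar-perp : ∀ f x y → polar f (perp₁ f x y) (perp₂ f x y) x y ≡ 0ℚ
polar-perp f = solve 5 (λ A B C x y →
  let w₁ = :- (B :* x :+ con 2ℚ :* C :* y); w₂ = con 2ℚ :* A :* x :+ B :* y in
  con 2ℚ :* A :* w₁ :* x :+ B :* (w₁ :* y :+ w₂ :* x) :+ con 2ℚ :* C :* w₂ :* y := con 0ℚ)
  refl (ι (a f)) (ι (b f)) (ι (c f))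

perp-nonZero : ∀ f x y → disc f ≢ 0ℤ → NonZeroPair x y → NonZeroPair (perp₁ f x y) (perp₂ f x y)
perp-nonZero f x y disc≢0 xy≢0 with perp₁ f x y ≟ 0ℚ | perp₂ f x y ≟ 0ℚ
... | no w₁≢0 | _        = inj₁ w₁≢0
... | yes _   | no w₂≢0  = inj₂ w₂≢0
... | yes w₁≡0 | yes w₂≡0 = contradiction (ι[z]≡0⇒z≡0 (disc f) (trans (ι-disc f) discQ≡0)) disc≢0
  where
  A = ι (a f); B = ι (b f); C = ι (c f)
  -- The linear map (x, y) ↦ (perp₁, perp₂) squares to discQ times the identity.
  discQ*x : discQ f * x ≡ (- B) * perp₁ f x y + (- (2ℚ * C)) * perp₂ f x y
  discQ*x = solve 5 (λ A B C x y →
    (B :* B :- con (ι (+ 4)) :* A :* C) :* x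
      := (:- B) :* (:- (B :* x :+ con 2ℚ :* C :* y)) :+ (:- (con 2ℚ :* C)) :* (con 2ℚ :* A :* x :+ B :* y))
    refl A B C x y
  discQ*y : discQ f * y ≡ B * perp₂ f x y + (2ℚ * A) * perp₁ f x y
  discQ*y = solve 5 (λ A B C x y →
    (B :* B :- con (ι (+ 4)) :* A :* C) :* y
      := B :* (con 2ℚ :* A :* x :+ B :* y) :+ (con 2ℚ :* A) :* (:- (B :* x :+ con 2ℚ :* C :* y)))
    refl A B C x y
  discQ≡0 : discQ f ≡ 0ℚ
  discQ≡0 = annihilator-of-nonZeroPair (discQ f) x y
    (trans discQ*x (trans (cong₂ (λ u v → (- B) * u + (- (2ℚ * C)) * v) w₁≡0 w₂≡0) (x*0+y*0≡0 (- B) (- (2ℚ * C)))))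
    (trans discQ*y (trans (cong₂ (λ u v → B * u + (2ℚ * A) * v) w₂≡0 w₁≡0) (x*0+y*0≡0 B (2ℚ * A))))
    xy≢0

evalQ-difference-along-line : ∀ f w₁ w₂ p₁ p₂ p₃ p₄ s t →
  evalQ f (s * w₁ + t * p₁) (s * w₂ + t * p₂) - evalQ f (s * w₁ + t * p₃) (s * w₂ + t * p₄)
    ≡ t * t * (evalQ f p₁ p₂ - evalQ f p₃ p₄) + s * t * polar f w₁ w₂ (p₁ - p₃) (p₂ - p₄)
evalQ-difference-along-line f w₁ w₂ p₁ p₂ p₃ p₄ s t = solve 11 (λ A B C w₁ w₂ p₁ p₂ p₃ p₄ s t →
  let F = λ x y → A :* x :* x :+ B :* x :* y :+ C :* y :* y in
  F (s :* w₁ :+ t :* p₁) (s :* w₂ :+ t :* p₂) :- F (s :* w₁ :+ t :* p₃) (s :* w₂ :+ t :* p₄)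
    := t :* t :* (F p₁ p₂ :- F p₃ p₄)
       :+ s :* t :* (con 2ℚ :* A :* w₁ :* (p₁ :- p₃) :+ B :* (w₁ :* (p₂ :- p₄) :+ w₂ :* (p₁ :- p₃))
                     :+ con 2ℚ :* C :* w₂ :* (p₂ :- p₄)))
  refl (ι (a f)) (ι (b f)) (ι (c f)) w₁ w₂ p₁ p₂ p₃ p₄ s t

lineInX-through : ∀ f w₁ w₂ p₁ p₂ p₃ p₄ → OnX f (q4 p₁ p₂ p₃ p₄) →
  polar f w₁ w₂ (p₁ - p₃) (p₂ - p₄) ≡ 0ℚ → LineInX f (q4 w₁ w₂ w₁ w₂) (q4 p₁ p₂ p₃ p₄)
lineInX-through f w₁ w₂ p₁ p₂ p₃ p₄ P∈X polar≡0 s t = x∙y⁻¹≈ε⇒x≈y _ _ (begin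
  evalQ f (s * w₁ + t * p₁) (s * w₂ + t * p₂) - evalQ f (s * w₁ + t * p₃) (s * w₂ + t * p₄)
    ≡⟨ evalQ-difference-along-line f w₁ w₂ p₁ p₂ p₃ p₄ s t ⟩
  t * t * (evalQ f p₁ p₂ - evalQ f p₃ p₄) + s * t * polar f w₁ w₂ (p₁ - p₃) (p₂ - p₄)
    ≡⟨ cong₂ (λ e π → t * t * e + s * t * π) (x≈y⇒x∙y⁻¹≈ε P∈X) polar≡0 ⟩
  t * t * 0ℚ + s * t * 0ℚ
    ≡⟨ x*0+y*0≡0 (t * t) (s * t) ⟩
  0ℚ ∎)
  where open ≡-Reasoning

linIndep-through : ∀ w₁ w₂ p₁ p₂ p₃ p₄ → NonZeroPair w₁ w₂ → NonZeroPair (p₁ - p₃) (p₂ - p₄) →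
  LinIndep (q4 w₁ w₂ w₁ w₂) (q4 p₁ p₂ p₃ p₄)
linIndep-through w₁ w₂ p₁ p₂ p₃ p₄ w≢0 d≢0 s t combination≡0 = s≡0 , t≡0
  where
  t*difference : ∀ w p q → t * (p - q) ≡ (s * w + t * p) - (s * w + t * q)
  t*difference = solve 5 (λ s t w p q → t :* (p :- q) := (s :* w :+ t :* p) :- (s :* w :+ t :* q)) refl s t
  t≡0 : t ≡ 0ℚ
  t≡0 = annihilator-of-nonZeroPair t (p₁ - p₃) (p₂ - p₄)
    (trans (t*difference w₁ p₁ p₃) (cong₂ _-_ (cong x₁ combination≡0) (cong x₃ combination≡0)))
    (trans (t*difference w₂ p₂ p₄) (cong₂ _-_ (cong x₂ combination≡0) (cong x₄ combination≡0)))
    d≢0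
  s*w≡s*w+t*p : ∀ w p → s * w ≡ s * w + t * p
  s*w≡s*w+t*p w p = trans (solve 3 (λ s w p → s :* w := s :* w :+ con 0ℚ :* p) refl s w p)
                            (cong (λ r → s * w + r * p) (sym t≡0))
  s≡0 : s ≡ 0ℚ
  s≡0 = annihilator-of-nonZeroPair s w₁ w₂
    (trans (s*w≡s*w+t*p w₁ p₁) (cong x₁ combination≡0))
    (trans (s*w≡s*w+t*p w₂ p₂) (cong x₂ combination≡0))
    w≢0

onLine-spanning-point : ∀ u P → OnLine P u P
onLine-spanning-point (q4 u₁ u₂ u₃ u₄) (q4 p₁ p₂ p₃ p₄) = 0ℚ , 1ℚ ,
  q4-cong (p≡0*u+1*p u₁ p₁) (p≡0*u+1*p u₂ p₂) (p≡0*u+1*p u₃ p₃) (p≡0*u+1*p u₄ p₄)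
  where
  q4-cong : ∀ {a b c d a′ b′ c′ d′} → a ≡ a′ → b ≡ b′ → c ≡ c′ → d ≡ d′ → q4 a b c d ≡ q4 a′ b′ c′ d′
  q4-cong refl refl refl refl = refl
  p≡0*u+1*p : ∀ u p → p ≡ 0ℚ * u + 1ℚ * p
  p≡0*u+1*p = solve 2 (λ u p → p := con 0ℚ :* u :+ con 1ℚ :* p) refl

RationalLineThrough : BQF → Q4 → Set
RationalLineThrough f P = ∃[ u ] ∃[ v ] (LinIndep u v × LineInX f u v × OnLine P u v)

line-through-nondiagonal-point : ∀ f p₁ p₂ p₃ p₄ → disc f ≢ 0ℤ → OnX f (q4 p₁ p₂ p₃ p₄) →
  NonZeroPair (p₁ - p₃) (p₂ - p₄) → RationalLineThrough f (q4 p₁ p₂ p₃ p₄)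
line-through-nondiagonal-point f p₁ p₂ p₃ p₄ disc≢0 P∈X d≢0 =
  q4 w₁ w₂ w₁ w₂ , P ,
  linIndep-through w₁ w₂ p₁ p₂ p₃ p₄ (perp-nonZero f d₁ d₂ disc≢0 d≢0) d≢0 ,
  lineInX-through f w₁ w₂ p₁ p₂ p₃ p₄ P∈X (polar-perp f d₁ d₂) ,
  onLine-spanning-point (q4 w₁ w₂ w₁ w₂) P
  where
  P = q4 p₁ p₂ p₃ p₄
  d₁ = p₁ - p₃; d₂ = p₂ - p₄
  w₁ = perp₁ f d₁ d₂; w₂ = perp₂ f d₁ d₂

line-through-diagonal-point : ∀ f p₁ p₂ → RationalLineThrough f (q4 p₁ p₂ p₁ p₂)
line-through-diagonal-point f p₁ p₂ =
  q4 1ℚ 0ℚ 1ℚ 0ℚ , q4 0ℚ 1ℚ 0ℚ 1ℚ ,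
  (λ s t combination≡0 → trans (sym (x*1+y*0≡x s t)) (cong x₁ combination≡0) ,
                         trans (sym (x*0+y*1≡y s t)) (cong x₂ combination≡0)) ,
  (λ s t → refl) ,
  p₁ , p₂ , sym (cong₂ (λ x y → q4 x y x y) (x*1+y*0≡x p₁ p₂) (x*0+y*1≡y p₁ p₂))
  where
  x*1+y*0≡x : ∀ x y → x * 1ℚ + y * 0ℚ ≡ x
  x*1+y*0≡x = solve 2 (λ x y → x :* con 1ℚ :+ y :* con 0ℚ := x) refl
  x*0+y*1≡y : ∀ x y → x * 0ℚ + y * 1ℚ ≡ y
  x*0+y*1≡y = solve 2 (λ x y → x :* con 0ℚ :+ y :* con 1ℚ := y) refl

corollary1p2 : (f : BQF) → ¬ (disc f ≡ 0ℤ) → (P : Q4) → RationalPoint f P →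
    ∃[ u ] ∃[ v ] (LinIndep u v × LineInX f u v × OnLine P u v)
corollary1p2 f disc≢0 (q4 p₁ p₂ p₃ p₄) (_ , P∈X) with p₁ - p₃ ≟ 0ℚ | p₂ - p₄ ≟ 0ℚ
... | no d₁≢0 | _        = line-through-nondiagonal-point f p₁ p₂ p₃ p₄ disc≢0 P∈X (inj₁ d₁≢0)
... | yes _   | no d₂≢0  = line-through-nondiagonal-point f p₁ p₂ p₃ p₄ disc≢0 P∈X (inj₂ d₂≢0)
... | yes d₁≡0 | yes d₂≡0 =
  subst₂ (λ p₃ p₄ → RationalLineThrough f (q4 p₁ p₂ p₃ p₄))
         (x∙y⁻¹≈ε⇒x≈y p₁ p₃ d₁≡0) (x∙y⁻¹≈ε⇒x≈y p₂ p₄ d₂≡0)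
         (line-through-diagonal-point f p₁ p₂)
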